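{- If $G$ is a graph, then $\gamma(G)\le \iota(G\,\Box\, K_2)\le \gamma(G\,\Box\, K_2)$. In addition, if $G$ is bipartite, then $\iota(G\,\Box\, K_2)=\gamma(G)$.
   Context: All graphs are finite and simple; $\Box$ is the Cartesian product and $\gamma$ the domination number. A set $A$ of vertices is isolating if no two vertices outside the closed neighborhood $N[A]$ are adjacent; $\iota$ is the minimum size of an isolating set. -}

module Defs where

open import Level using (0ℓ)
open import Data.Nat using (ℕ; _≤_)
open import Data.Fin using (Fin; remQuot)
open import Data.Fin.Subset using (Subset; _∈_; _∉_; ∣_∣)
open import Data.Product using (Σ; ∃; _×_; _,_; proj₁; proj₂)
open import Data.Sum using (_⊎_)
open import Relation.Binary using (Rel; Symmetric)
open import Relation.Binary.PropositionalEquality using (_≡_; _≢_)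
open import Relation.Nullary using (¬_)

record Graph : Set₁ where
  field
    n     : ℕ
    Adj   : Rel (Fin n) 0ℓ
    adj-sym : Symmetric Adj
    irrefl : ∀ v → ¬ Adj v v
open Graph public

V : Graph → Set
V G = Fin (n G)

InClosedNbhd : (G : Graph) → Subset (n G) → V G → Set
InClosedNbhd G A v = v ∈ A ⊎ ∃ λ a → a ∈ A × Adj G a v

Dominating : (G : Graph) → Subset (n G) → Set
Dominating G D = ∀ v → InClosedNbhd G D v

Isolating : (G : Graph) → Subset (n G) → Set
Isolating G A = ∀ u v → ¬ InClosedNbhd G A u → ¬ InClosedNbhd G A v → ¬ Adj G u v

IsMinSize : ∀ {m} → (Subset m → Set) → ℕ → Set
IsMinSize {m} P k = (Σ (Subset m) λ S → P S × ∣ S ∣ ≡ k) × (∀ S → P S → k ≤ ∣ S ∣)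

IsDominationNumber : Graph → ℕ → Set
IsDominationNumber G k = IsMinSize (Dominating G) k

IsIsolationNumber : Graph → ℕ → Set
IsIsolationNumber G k = IsMinSize (Isolating G) k

-- K₂ on vertex set Fin 2.
-- Cartesian product G □ K₂, vertex set Fin (n * 2), vertex x ↔ (u , i) = remQuot 2 x.
-- (u , i) ~ (v , j) iff (u ≡ v and i ≢ j) or (i ≡ j and u ~ v in G).
-- projections of a vertex of G □ K₂ to its G-part and its K₂-part
gpart : (G : Graph) → Fin (n G Data.Nat.* 2) → V G
gpart G x = proj₁ (remQuot {n G} 2 x)

kpart : (G : Graph) → Fin (n G Data.Nat.* 2) → Fin 2
kpart G x = proj₂ (remQuot {n G} 2 x)

□K₂-Adj : (G : Graph) → Rel (Fin (n G Data.Nat.* 2)) 0ℓ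
□K₂-Adj G x y =
  (gpart G x ≡ gpart G y × kpart G x ≢ kpart G y)
  ⊎ (kpart G x ≡ kpart G y × Adj G (gpart G x) (gpart G y))

private
  open import Relation.Binary.PropositionalEquality using (sym)
  open import Data.Sum using (inj₁; inj₂)
  open import Data.Empty using (⊥-elim)

  □sym : (G : Graph) → Symmetric (□K₂-Adj G)
  □sym G (inj₁ (p , q)) = inj₁ (sym p , λ e → q (sym e))
  □sym G (inj₂ (p , a)) = inj₂ (sym p , adj-sym G a)

  □irr : (G : Graph) → ∀ x → ¬ □K₂-Adj G x x
  □irr G x (inj₁ (_ , q)) = q Relation.Binary.PropositionalEquality.refl
  □irr G x (inj₂ (_ , a)) = irrefl G _ a

_□K₂ : Graph → Graph
G □K₂ = record { n = n G Data.Nat.* 2 ; Adj = □K₂-Adj G ; adj-sym = □sym G ; irrefl = □irr G }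

Bipartite : Graph → Set
Bipartite G = Σ (V G → Fin 2) λ c → ∀ u v → Adj G u v → c u ≢ c v

-- A set A of vertices of G □ K₂ casts a shadow on G (its projection), no larger than A.
-- If A isolates, every vertex v of G is dominated by the shadow: otherwise both copies
-- (v , 0) and (v , 1) lie outside N[A], yet they are adjacent. A dominating set isolates
-- trivially. For bipartite G with proper colouring c, a dominating set D of G lifts to
-- {(u , c u) | u ∈ D} of the same size, and any vertex (u , i) outside its closed
-- neighbourhood has i = c u; two such vertices are never adjacent, since a vertical edge
-- would join equal layers and a horizontal one equal colours.
module Submission where

open import Defs
open import Data.Bool using (Bool; _∨_)
open import Data.Fin using (Fin; zero; suc; combine)
open import Data.Fin.Properties using (remQuot-combine; combine-remQuot; _≟_)
open import Data.Fin.Subset using (Subset; inside; outside; _∈_; ∣_∣)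
open import Data.Fin.Subset.Properties using (∣p∣≤∣x∷p∣)
open import Data.Nat using (ℕ; _≤_; _+_; _*_; z≤n; s≤s; _≤?_)
open import Data.Nat.Properties using (≤-refl; ≤-trans; ≤-reflexive; ≤-antisym)
open import Data.Product using (∃; _×_; _,_; proj₁; proj₂)
open import Data.Sum using (inj₁; inj₂)
open import Data.Vec using ([]; _∷_; here; there)
open import Function using (_∘_)
open import Relation.Binary.PropositionalEquality
  using (_≡_; _≢_; refl; sym; trans; cong; subst; subst₂; module ≡-Reasoning)
open import Relation.Nullary using (¬_; yes; no; contradiction)
open import Relation.Nullary.Negation using (¬¬-map)
open import Relation.Nullary.Decidable using (decidable-stable)

¬¬-Π-Fin : ∀ {m} {P : Fin m → Set} → (∀ i → ¬ ¬ P i) → ¬ ¬ (∀ i → P i)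
¬¬-Π-Fin {ℕ.zero} _ ¬all = ¬all λ ()
¬¬-Π-Fin {ℕ.suc m} {P} ¬¬P ¬all =
  ¬¬P zero λ P0 → ¬¬-Π-Fin {m} {P ∘ suc} (¬¬P ∘ suc) λ Psuc →
    ¬all λ { zero → P0 ; (suc i) → Psuc i }

Fin2-≢⇒≡ : {i j k : Fin 2} → i ≢ k → j ≢ k → i ≡ j
Fin2-≢⇒≡ {zero}     {zero}                 _   _   = refl
Fin2-≢⇒≡ {suc zero} {suc zero}             _   _   = refl
Fin2-≢⇒≡ {zero}     {suc zero} {zero}     i≢k _   = contradiction refl i≢k
Fin2-≢⇒≡ {zero}     {suc zero} {suc zero} _   j≢k = contradiction refl j≢k
Fin2-≢⇒≡ {suc zero} {zero}     {zero}     _   j≢k = contradiction refl j≢k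
Fin2-≢⇒≡ {suc zero} {zero}     {suc zero} i≢k _   = contradiction refl i≢k

-- Subsets of Fin (n * 2) are stored column by column: combine u i is entry 2u + i.
shadow : ∀ {n} → Subset (n * 2) → Subset n
shadow {ℕ.zero}  []            = []
shadow {ℕ.suc n} (a ∷ b ∷ S) = (a ∨ b) ∷ shadow {n} S

∣shadow∣≤∣S∣ : ∀ {n} (S : Subset (n * 2)) → ∣ shadow {n} S ∣ ≤ ∣ S ∣
∣shadow∣≤∣S∣ {ℕ.zero}  []                      = z≤n
∣shadow∣≤∣S∣ {ℕ.suc n} (inside  ∷ b       ∷ S) =
  s≤s (≤-trans (∣shadow∣≤∣S∣ {n} S) (∣p∣≤∣x∷p∣ b S))
∣shadow∣≤∣S∣ {ℕ.suc n} (outside ∷ inside  ∷ S) = s≤s (∣shadow∣≤∣S∣ {n} S)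
∣shadow∣≤∣S∣ {ℕ.suc n} (outside ∷ outside ∷ S) = ∣shadow∣≤∣S∣ {n} S

combine∈⇒∈shadow : ∀ {n} (u : Fin n) (i : Fin 2) {S : Subset (n * 2)} →
  combine u i ∈ S → u ∈ shadow {n} S
combine∈⇒∈shadow zero    zero       {_       ∷ _ ∷ _} here         = here
combine∈⇒∈shadow zero    (suc zero) {inside  ∷ _ ∷ _} (there here) = here
combine∈⇒∈shadow zero    (suc zero) {outside ∷ _ ∷ _} (there here) = here
combine∈⇒∈shadow (suc u) i          {_       ∷ _ ∷ _} (there (there p)) =
  there (combine∈⇒∈shadow u i p)

slot : ∀ {m} → Fin 2 → Bool → Subset m → Subset (2 + m)
slot zero       b S = b ∷ outside ∷ S
slot (suc zero) b S = outside ∷ b ∷ S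

lift : ∀ {n} → (Fin n → Fin 2) → Subset n → Subset (n * 2)
lift {ℕ.zero}  c []      = []
lift {ℕ.suc n} c (b ∷ D) = slot (c zero) b (lift (c ∘ suc) D)

∣lift∣≡∣D∣ : ∀ {n} (c : Fin n → Fin 2) (D : Subset n) → ∣ lift c D ∣ ≡ ∣ D ∣
∣lift∣≡∣D∣ {ℕ.zero}  c []      = refl
∣lift∣≡∣D∣ {ℕ.suc n} c (b ∷ D) = ∣slot∣ (c zero) b {T = D} (∣lift∣≡∣D∣ (c ∘ suc) D)
  where
  ∣slot∣ : ∀ {m k} i b {S : Subset m} {T : Subset k} →
    ∣ S ∣ ≡ ∣ T ∣ → ∣ slot i b S ∣ ≡ ∣ b ∷ T ∣
  ∣slot∣ zero       inside  eq = cong ℕ.suc eq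
  ∣slot∣ zero       outside eq = eq
  ∣slot∣ (suc zero) inside  eq = cong ℕ.suc eq
  ∣slot∣ (suc zero) outside eq = eq

∈⇒combine∈lift : ∀ {n} (c : Fin n → Fin 2) {D : Subset n} {u} →
  u ∈ D → combine u (c u) ∈ lift c D
∈⇒combine∈lift c {_ ∷ _} here with c zero
... | zero     = here
... | suc zero = there here
∈⇒combine∈lift c {_ ∷ _} (there p) with c zero
... | zero     = there (there (∈⇒combine∈lift (c ∘ suc) p))
... | suc zero = there (there (∈⇒combine∈lift (c ∘ suc) p))

-- Double negation is harmless here because k ≤ l is decidable; it is needed because
-- adjacency is not, so domination by a shadow cannot be established vertex by vertex.
IsMinSize-mono-¬¬ : ∀ {m m′} {P : Subset m → Set} {Q : Subset m′ → Set} {k l} →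
  IsMinSize P k → IsMinSize Q l →
  (∀ S → Q S → ¬ ¬ (∃ λ T → P T × ∣ T ∣ ≤ ∣ S ∣)) → k ≤ l
IsMinSize-mono-¬¬ {P = P} {k = k} {l} (_ , minimal) ((S , QS , ∣S∣≡l) , _) shrink =
  decidable-stable (_ ≤? _) (¬¬-map bound (shrink S QS))
  where
  bound : (∃ λ T → P T × ∣ T ∣ ≤ ∣ S ∣) → k ≤ l
  bound (T , PT , ∣T∣≤∣S∣) =
    ≤-trans (minimal T PT) (≤-trans ∣T∣≤∣S∣ (≤-reflexive ∣S∣≡l))

IsMinSize-mono : ∀ {m m′} {P : Subset m → Set} {Q : Subset m′ → Set} {k l} →
  IsMinSize P k → IsMinSize Q l →
  (∀ S → Q S → ∃ λ T → P T × ∣ T ∣ ≤ ∣ S ∣) → k ≤ l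
IsMinSize-mono minP minQ shrink = IsMinSize-mono-¬¬ minP minQ λ S QS ¬T → ¬T (shrink S QS)

Dominating⇒Isolating : (G : Graph) {D : Subset (n G)} → Dominating G D → Isolating G D
Dominating⇒Isolating G dom u _ u∉N[D] _ _ = u∉N[D] (dom u)

module _ (G : Graph) where

  gpart-combine : ∀ u i → gpart G (combine u i) ≡ u
  gpart-combine u i = cong proj₁ (remQuot-combine u i)

  kpart-combine : ∀ u i → kpart G (combine {n G} u i) ≡ i
  kpart-combine u i = cong proj₂ (remQuot-combine u i)

  combine-parts : ∀ x → combine (gpart G x) (kpart G x) ≡ x
  combine-parts = combine-remQuot {n G} 2

  vertical : ∀ {u i j} → i ≢ j → Adj (G □K₂) (combine u i) (combine u j)
  vertical {u} {i} {j} i≢j =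
    inj₁ ( trans (gpart-combine u i) (sym (gpart-combine u j))
         , λ eq → i≢j (trans (sym (kpart-combine u i)) (trans eq (kpart-combine u j))) )

  horizontal : ∀ {u v i} → Adj G u v → Adj (G □K₂) (combine u i) (combine v i)
  horizontal {u} {v} {i} u~v =
    inj₂ ( trans (kpart-combine u i) (sym (kpart-combine v i))
         , subst₂ (Adj G) (sym (gpart-combine u i)) (sym (gpart-combine v i)) u~v )

  ∈⇒gpart∈shadow : ∀ {A x} → x ∈ A → gpart G x ∈ shadow {n G} A
  ∈⇒gpart∈shadow {A} {x} x∈A =
    combine∈⇒∈shadow (gpart G x) (kpart G x) (subst (_∈ A) (sym (combine-parts x)) x∈A)

  gpart-closedNbhd : ∀ {A x} →
    InClosedNbhd (G □K₂) A x → InClosedNbhd G (shadow A) (gpart G x)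
  gpart-closedNbhd (inj₁ x∈A) = inj₁ (∈⇒gpart∈shadow x∈A)
  gpart-closedNbhd {A} (inj₂ (y , y∈A , inj₁ (same-gpart , _))) =
    inj₁ (subst (_∈ shadow A) same-gpart (∈⇒gpart∈shadow y∈A))
  gpart-closedNbhd (inj₂ (y , y∈A , inj₂ (_ , gy~gx))) =
    inj₂ (gpart G y , ∈⇒gpart∈shadow y∈A , gy~gx)

  shadow-¬¬dominates : ∀ {A} → Isolating (G □K₂) A →
    ∀ v → ¬ ¬ InClosedNbhd G (shadow A) v
  shadow-¬¬dominates {A} isolating v v∉N[shadow] =
    isolating _ _ (copy∉ zero) (copy∉ (suc zero)) (vertical λ ())
    where
    copy∉ : ∀ i → ¬ InClosedNbhd (G □K₂) A (combine v i)
    copy∉ i = v∉N[shadow] ∘ subst (InClosedNbhd G (shadow A)) (gpart-combine v i)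
                          ∘ gpart-closedNbhd

module _ (G : Graph) (c : V G → Fin 2) (proper : ∀ u v → Adj G u v → c u ≢ c v)
         {D : Subset (n G)} (dom : Dominating G D) where

  outside-lift-coloured : ∀ x → ¬ InClosedNbhd (G □K₂) (lift c D) x →
    kpart G x ≡ c (gpart G x)
  outside-lift-coloured x x∉ = coloured (gpart G x) (kpart G x)
    (x∉ ∘ subst (InClosedNbhd (G □K₂) (lift c D)) (combine-parts G x))
    where
    coloured : ∀ u i → ¬ InClosedNbhd (G □K₂) (lift c D) (combine u i) → i ≡ c u
    coloured u i ui∉ with i ≟ c u | dom u
    ... | yes i≡cu | _ = i≡cu
    ... | no i≢cu | inj₁ u∈D =
      contradiction (inj₂ (_ , ∈⇒combine∈lift c u∈D , vertical G (i≢cu ∘ sym))) ui∉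
    ... | no i≢cu | inj₂ (d , d∈D , d~u) =
      contradiction (inj₂ (_ , ∈⇒combine∈lift c d∈D , d~u-in-layer)) ui∉
      where
      d~u-in-layer : Adj (G □K₂) (combine d (c d)) (combine u i)
      d~u-in-layer = subst (λ j → Adj (G □K₂) (combine d j) (combine u i))
                           (Fin2-≢⇒≡ i≢cu (proper d u d~u)) (horizontal G d~u)

  lift-isolating : Isolating (G □K₂) (lift c D)
  lift-isolating x y x∉ y∉ (inj₁ (same-gpart , kx≢ky)) = kx≢ky (begin
    kpart G x     ≡⟨ outside-lift-coloured x x∉ ⟩
    c (gpart G x) ≡⟨ cong c same-gpart ⟩
    c (gpart G y) ≡⟨ outside-lift-coloured y y∉ ⟨
    kpart G y     ∎)
    where open ≡-Reasoning
  lift-isolating x y x∉ y∉ (inj₂ (same-kpart , gx~gy)) = proper _ _ gx~gy (begin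
    c (gpart G x) ≡⟨ outside-lift-coloured x x∉ ⟨
    kpart G x     ≡⟨ same-kpart ⟩
    kpart G y     ≡⟨ outside-lift-coloured y y∉ ⟩
    c (gpart G y) ∎)
    where open ≡-Reasoning

theorem3p7 : (G : Graph) (γG ιGK γGK : ℕ) →
    IsDominationNumber G γG →
    IsIsolationNumber (G □K₂) ιGK →
    IsDominationNumber (G □K₂) γGK →
    (γG ≤ ιGK × ιGK ≤ γGK) × (Bipartite G → ιGK ≡ γG)
theorem3p7 G γG ιGK γGK γ-min ι□-min γ□-min =
  (γ≤ι□ , ι□≤γ□) , λ (c , proper) → ≤-antisym (ι□≤γ c proper) γ≤ι□
  where
  γ≤ι□ : γG ≤ ιGK
  γ≤ι□ = IsMinSize-mono-¬¬ γ-min ι□-min λ A isolating →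
    ¬¬-map (λ dom → shadow A , dom , ∣shadow∣≤∣S∣ {n G} A)
           (¬¬-Π-Fin (shadow-¬¬dominates G isolating))

  ι□≤γ□ : ιGK ≤ γGK
  ι□≤γ□ = IsMinSize-mono ι□-min γ□-min λ D dom →
    D , Dominating⇒Isolating (G □K₂) dom , ≤-refl

  ι□≤γ : ∀ c → (∀ u v → Adj G u v → c u ≢ c v) → ιGK ≤ γG
  ι□≤γ c proper = IsMinSize-mono ι□-min γ-min λ D dom →
    lift c D , lift-isolating G c proper dom , ≤-reflexive (∣lift∣≡∣D∣ c D)
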